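{- Let $(P_0,P_1)$ be an equitable $2$-partition of the halved $n$-cube $\frac12 H(n)$ with quotient matrix $\begin{pmatrix} a & b\\ c & d\end{pmatrix}$, and assume that for some $s$ the cell $P_1$ is partitioned into $s$-faces; for $\bar v\in P_1$ let $F(\bar v)$ denote the face of this partition containing $\bar v$. Write the vertices of $\frac12 H(2n)$ as $(\bar x,\bar y)$ with $\bar x,\bar y\in\{0,1\}^n$ (so $\bar x+\bar y$ has even weight), and let $P^{(2)}(\bar x,\bar y):=P(\bar x+\bar y)$, i.e. the index $i$ with $\bar x+\bar y\in P_i$. For $(\bar x,\bar y)$ with $\bar x+\bar y\in P_1$ define $\mathrm{sign}(\bar x,\bar y):=x_1+\cdots+x_n+b_1y_1+\cdots+b_ny_n \pmod 2$, where $\bar b=(b_1,\ldots,b_n)$ has $1$s in the free coordinates of the face $F(\bar x+\bar y)$ and $0$s in its fixed coordinates. Define $$C'(\bar v):=\begin{cases}0 & \text{if } P^{(2)}(\bar v)=0,\\ 1 & \text{if } P^{(2)}(\bar v)=1 \text{ and } \mathrm{sign}(\bar v)=0,\\ 2 & \text{if } P^{(2)}(\bar v)=1 \text{ and } \mathrm{sign}(\bar v)=1.\end{cases}$$ Then $C'$ is an equitable $3$-partition of $\frac12 H(2n)$ with quotient matrix $$\begin{pmatrix} 4a+n & 2b & 2b\\ 4c & 2d+s^2 & 2d+n-s^2\\ 4c & 2d+n-s^2 & 2d+s^2\end{pmatrix}.$$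
   Context: The halved $m$-cube $\frac12 H(m)$ is the graph on the binary words of length $m$ with an even number of ones, two words adjacent iff they differ in exactly two positions. An $s$-face of $\frac12 H(n)$ is the set of $2^{s-1}$ vertices having prescribed values in some $n-s$ fixed coordinates; the remaining $s$ coordinates are called free. An equitable $k$-partition is an ordered partition $(C_0,\ldots,C_{k-1})$ of the vertex set such that the number of neighbors in $C_j$ of any vertex of $C_i$ is a constant $S_{ij}$; $S=(S_{ij})$ is the quotient matrix. A partition is identified with the function mapping each vertex to the index of its cell. -}

module Defs where

open import Data.Bool using (Bool; true; false; _xor_; _∧_; if_then_else_)
import Data.Bool as B
open import Data.Nat using (ℕ; zero; suc; _+_; _*_; _∸_; _^_)
import Data.Nat as N
open import Data.Fin using (Fin; zero; suc)
import Data.Fin as F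
open import Data.Vec using (Vec; []; _∷_; zipWith; take; drop)
open import Data.List using (List; length; filter; _++_; map)
import Data.List as L
open import Data.Maybe using (Maybe; just; nothing; is-nothing)
open import Data.Product using (_×_)
open import Relation.Binary.PropositionalEquality using (_≡_)
open import Relation.Nullary.Decidable using (_×-dec_)

Word : ℕ → Set
Word m = Vec Bool m

weight : ∀ {m} → Word m → ℕ
weight [] = 0
weight (true ∷ v) = suc (weight v)
weight (false ∷ v) = weight v

parity : ∀ {m} → Word m → Bool
parity [] = false
parity (x ∷ v) = x xor parity v

-- vertices of the halved m-cube: words of even weight
Even : ∀ {m} → Word m → Set
Even v = parity v ≡ false

dist : ∀ {m} → Word m → Word m → ℕ
dist u v = weight (zipWith _xor_ u v)

allWords : (m : ℕ) → List (Word m)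
allWords zero = [] L.∷ L.[]
allWords (suc m) = map (false ∷_) (allWords m) ++ map (true ∷_) (allWords m)

-- number of neighbours of v in ½H(m) (even words at distance exactly 2) lying in cell j of f
neighboursIn : ∀ {m k} → (Word m → Fin k) → Word m → Fin k → ℕ
neighboursIn f v j =
  length (filter (λ u → (parity u B.≟ false) ×-dec ((dist v u N.≟ 2) ×-dec (f u F.≟ j))) (allWords _))

Equitable : (m k : ℕ) → (Word m → Fin k) → (Fin k → Fin k → ℕ) → Set
Equitable m k f S = ∀ (v : Word m) → Even v → ∀ (j : Fin k) → neighboursIn f v j ≡ S (f v) j

-- a face: for each coordinate, nothing = free, just b = fixed to value b
Face : ℕ → Set
Face n = Vec (Maybe Bool) n

numFree : ∀ {n} → Face n → ℕ
numFree [] = 0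
numFree (nothing ∷ φ) = suc (numFree φ)
numFree (just _ ∷ φ) = numFree φ

-- v has the prescribed values in the fixed coordinates of φ
-- (the vertices of the face are the even words v with InFace φ v)
InFace : ∀ {n} → Face n → Word n → Set
InFace [] [] = Data.Unit.⊤ where import Data.Unit
InFace (nothing ∷ φ) (_ ∷ v) = InFace φ v
InFace (just b ∷ φ) (x ∷ v) = (x ≡ b) × InFace φ v

freeMask : ∀ {n} → Face n → Word n
freeMask [] = []
freeMask (c ∷ φ) = is-nothing c ∷ freeMask φ

one : Fin 2
one = suc zero

-- F assigns to every vertex of P₁ its face; the faces form a partition of P₁ into s-faces:
-- F v is an s-face containing v, all vertices of F v lie in P₁ and have the same face.
IsFacePartition : (n s : ℕ) → (Word n → Fin 2) → (Word n → Face n) → Set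
IsFacePartition n s P F =
  ∀ (v : Word n) → Even v → P v ≡ one →
    (numFree (F v) ≡ s) × InFace (F v) v ×
    (∀ (u : Word n) → Even u → InFace (F v) u → (P u ≡ one) × (F u ≡ F v))

-- the partition C' of ½H(n+n); a word w is split as (x̄, ȳ) = (first n, last n coordinates)
C' : (n : ℕ) → (Word n → Fin 2) → (Word n → Face n) → Word (n + n) → Fin 3
C' n P F w = pick (P z)
  where
  x = take n w
  y = drop n w
  z = zipWith _xor_ x y
  sign = parity x xor parity (zipWith _∧_ (freeMask (F z)) y)
  pick : Fin 2 → Fin 3
  pick zero = zero
  pick (suc zero) = if sign then suc (suc zero) else suc zero

mat2 : (a b c d : ℕ) → Fin 2 → Fin 2 → ℕ
mat2 a b c d zero zero = a
mat2 a b c d zero (suc zero) = b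
mat2 a b c d (suc zero) zero = c
mat2 a b c d (suc zero) (suc zero) = d

-- 2d+n-s² is written (2*d + n) ∸ s^2
mat3 : (a b c d n s : ℕ) → Fin 3 → Fin 3 → ℕ
mat3 a b c d n s zero zero = 4 * a + n
mat3 a b c d n s zero (suc zero) = 2 * b
mat3 a b c d n s zero (suc (suc zero)) = 2 * b
mat3 a b c d n s (suc zero) zero = 4 * c
mat3 a b c d n s (suc zero) (suc zero) = 2 * d + s ^ 2
mat3 a b c d n s (suc zero) (suc (suc zero)) = (2 * d + n) ∸ s ^ 2
mat3 a b c d n s (suc (suc zero)) zero = 4 * c
mat3 a b c d n s (suc (suc zero)) (suc zero) = (2 * d + n) ∸ s ^ 2
mat3 a b c d n s (suc (suc zero)) (suc (suc zero)) = 2 * d + s ^ 2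

-- Write a vertex of ½H(2n) as (x, y) and put z = x ⊕ y. Toggling two coordinates of (x, y) either
-- changes z in two positions i, k, or (toggling position i on both sides) leaves z fixed. Each pair
-- i, k contributes four neighbours lying over z′ = z with i, k toggled: (x ⊕ eᵢ ⊕ eₖ, y),
-- (x, y ⊕ eᵢ ⊕ eₖ), (x ⊕ eᵢ, y ⊕ eₖ) and (x ⊕ eₖ, y ⊕ eᵢ). If z′ ∈ P₁, two of them have sign 0 and two
-- sign 1, except when i and k are both free in the face of z′; then z lies in that face as well, and
-- all four have the sign of (x, y). The n diagonal neighbours lie over z itself, and (x ⊕ eᵢ, y ⊕ eᵢ)
-- keeps the sign of (x, y) exactly when i is free in the face of z. Summing over i, k with the quotient
-- matrix of P, and using s² = s + 2·#(pairs of free coordinates), yields the quotient matrix of C'.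
module Submission where

open import Defs
open import Algebra.Bundles using (CommutativeRing)
open import Data.Bool using (Bool; true; false; not; _xor_; _∧_; if_then_else_)
import Data.Bool as B
open import Data.Bool.Properties
  using ( xor-∧-commutativeRing; xor-identityʳ; xor-assoc; xor-comm
        ; not-involutive; not-distribˡ-xor; not-distribʳ-xor)
open import Data.Fin using (Fin; zero; suc; _≟_)
open import Data.Fin.Patterns using (0F; 1F; 2F)
open import Data.List using (List; length; filter; map)
open import Data.List.Properties using (filter-++; length-++)
open import Data.Maybe using (just; nothing)
import Data.Nat as ℕ
open import Data.Nat using (ℕ; zero; suc; _+_; _*_; _∸_; _^_; _≡ᵇ_)
open import Data.Nat.Properties
  using ( +-0-commutativeMonoid; +-commutativeSemigroup
        ; +-assoc; +-comm; +-identityʳ; *-zeroʳ; *-distribˡ-+; m+n∸n≡m)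
open import Data.Nat.Tactic.RingSolver using (solve-∀)
open import Data.Product using (_×_; _,_; proj₁; proj₂)
open import Data.Sum using (_⊎_; inj₁; inj₂)
open import Data.Vec using (Vec; []; _∷_; _++_; zipWith; take; drop; lookup; updateAt)
open import Data.Vec.Properties using (++-injective; take++drop≡id; updateAt-updateAt-local; updateAt-id)
open import Function using (_∘_)
open import Relation.Binary.PropositionalEquality
open import Relation.Nullary using (does; contradiction)
open import Relation.Nullary.Decidable using (_×-dec_)
open import Relation.Unary using (Decidable)
open import Algebra.Properties.CommutativeMonoid.Sum +-0-commutativeMonoid
  using (sum; sum-syntax; sum-cong-≗; ∑-distrib-+; sum-replicate-zero)
open import Algebra.Properties.CommutativeSemigroup +-commutativeSemigroup
  using () renaming (interchange to +-interchange)
open ≡-Reasoning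

-- Finite sums

𝟙 : Bool → ℕ
𝟙 true = 1
𝟙 false = 0

δ : ∀ {k} → Fin k → Fin k → ℕ
δ i j = 𝟙 (does (i ≟ j))

∑-*ˡ : ∀ {n} k (f : Fin n → ℕ) → ∑[ i < n ] (k * f i) ≡ k * ∑[ i < n ] f i
∑-*ˡ {zero} k f = sym (*-zeroʳ k)
∑-*ˡ {suc n} k f = trans (cong (k * f zero +_) (∑-*ˡ k (f ∘ suc))) (sym (*-distribˡ-+ k _ _))

∑-ones : ∀ n → ∑[ i < n ] 1 ≡ n
∑-ones zero = refl
∑-ones (suc n) = cong suc (∑-ones n)

count-complement : ∀ {n} (f : Fin n → Bool) → ∑[ i < n ] 𝟙 (f i) + ∑[ i < n ] 𝟙 (not (f i)) ≡ n
count-complement {n} f =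
  trans (sym (∑-distrib-+ (λ i → 𝟙 (f i)) (λ i → 𝟙 (not (f i)))))
        (trans (sum-cong-≗ (λ i → 𝟙-complement (f i))) (∑-ones n))
  where
  𝟙-complement : ∀ b → 𝟙 b + 𝟙 (not b) ≡ 1
  𝟙-complement true = refl
  𝟙-complement false = refl

pairSum : ∀ n → (Fin n → Fin n → ℕ) → ℕ
pairSum zero f = 0
pairSum (suc n) f = ∑[ k < n ] f zero (suc k) + pairSum n (λ i k → f (suc i) (suc k))

infixl 10 pairSum
syntax pairSum n (λ i k → e) = ∑[ i < k < n ] e

pairSum-cong : ∀ {n} {f g : Fin n → Fin n → ℕ} → (∀ i k → f i k ≡ g i k) → pairSum n f ≡ pairSum n g
pairSum-cong {zero} f≗g = refl
pairSum-cong {suc n} f≗g =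
  cong₂ _+_ (sum-cong-≗ (λ k → f≗g zero (suc k))) (pairSum-cong (λ i k → f≗g (suc i) (suc k)))

pairSum-distrib-+ : ∀ {n} (f g : Fin n → Fin n → ℕ) →
  ∑[ i < k < n ] (f i k + g i k) ≡ ∑[ i < k < n ] f i k + ∑[ i < k < n ] g i k
pairSum-distrib-+ {zero} f g = refl
pairSum-distrib-+ {suc n} f g =
  trans (cong₂ _+_ (∑-distrib-+ (λ k → f zero (suc k)) (λ k → g zero (suc k)))
                   (pairSum-distrib-+ (λ i k → f (suc i) (suc k)) (λ i k → g (suc i) (suc k))))
        (+-interchange (∑[ k < n ] f zero (suc k)) (∑[ k < n ] g zero (suc k))
                       (∑[ i < k < n ] f (suc i) (suc k)) (∑[ i < k < n ] g (suc i) (suc k)))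

pairSum-*ˡ : ∀ {n} c (f : Fin n → Fin n → ℕ) → ∑[ i < k < n ] (c * f i k) ≡ c * ∑[ i < k < n ] f i k
pairSum-*ˡ {zero} c f = sym (*-zeroʳ c)
pairSum-*ˡ {suc n} c f =
  trans (cong₂ _+_ (∑-*ˡ c (λ k → f zero (suc k))) (pairSum-*ˡ c (λ i k → f (suc i) (suc k))))
        (sym (*-distribˡ-+ c _ _))

∑∑-diagonal : ∀ {n} (h : Fin n → Fin n → ℕ) →
  ∑[ i < n ] ∑[ k < n ] h i k ≡ ∑[ i < n ] h i i + ∑[ i < k < n ] (h i k + h k i)
∑∑-diagonal {zero} h = refl
∑∑-diagonal {suc n} h = begin
  (h₀₀ + ∑[ k < n ] h zero (suc k)) + ∑[ i < n ] (h (suc i) zero + ∑[ k < n ] h (suc i) (suc k))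
    ≡⟨ cong (h₀₀ + ∑[ k < n ] h zero (suc k) +_)
            (trans (∑-distrib-+ (λ i → h (suc i) zero) (λ i → ∑[ k < n ] h (suc i) (suc k)))
                   (cong (∑[ i < n ] h (suc i) zero +_) (∑∑-diagonal (λ i k → h (suc i) (suc k))))) ⟩
  (h₀₀ + ∑[ k < n ] h zero (suc k)) + (∑[ i < n ] h (suc i) zero + (∑[ i < n ] h (suc i) (suc i) + pairs))
    ≡⟨ regroup h₀₀ _ _ _ pairs ⟩
  (h₀₀ + ∑[ i < n ] h (suc i) (suc i)) + ((∑[ k < n ] h zero (suc k) + ∑[ k < n ] h (suc k) zero) + pairs)
    ≡⟨ cong (λ t → h₀₀ + ∑[ i < n ] h (suc i) (suc i) + (t + pairs))
            (∑-distrib-+ (λ k → h zero (suc k)) (λ k → h (suc k) zero)) ⟨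
  (h₀₀ + ∑[ i < n ] h (suc i) (suc i)) + (∑[ k < n ] (h zero (suc k) + h (suc k) zero) + pairs) ∎
  where
  h₀₀ = h zero zero
  pairs = ∑[ i < k < n ] (h (suc i) (suc k) + h (suc k) (suc i))
  regroup : ∀ a x y d p → (a + x) + (y + (d + p)) ≡ (a + d) + ((x + y) + p)
  regroup = solve-∀

count-square : ∀ {n} (f : Fin n → Bool) →
  (∑[ i < n ] 𝟙 (f i)) ^ 2 ≡ ∑[ i < n ] 𝟙 (f i) + 2 * ∑[ i < k < n ] 𝟙 (f i ∧ f k)
count-square {zero} f = refl
count-square {suc n} f = begin
  (a + S) ^ 2
    ≡⟨ square-+ a S ⟩
  a * a + S ^ 2 + 2 * (a * S)
    ≡⟨ cong₂ (λ t u → t + u + 2 * (a * S)) (𝟙-idem (f zero)) (count-square (f ∘ suc)) ⟩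
  a + (S + 2 * C) + 2 * (a * S)
    ≡⟨ regroup a S C ⟩
  a + S + 2 * (a * S + C)
    ≡⟨ cong (λ t → a + S + 2 * (t + C)) (∑-*ˡ a (λ k → 𝟙 (f (suc k)))) ⟨
  a + S + 2 * (∑[ k < n ] (a * 𝟙 (f (suc k))) + C)
    ≡⟨ cong (λ t → a + S + 2 * (t + C)) (sum-cong-≗ (λ k → 𝟙-∧ (f zero) (f (suc k)))) ⟨
  a + S + 2 * (∑[ k < n ] 𝟙 (f zero ∧ f (suc k)) + C) ∎
  where
  a = 𝟙 (f zero)
  S = ∑[ i < n ] 𝟙 (f (suc i))
  C = ∑[ i < k < n ] 𝟙 (f (suc i) ∧ f (suc k))
  𝟙-idem : ∀ b → 𝟙 b * 𝟙 b ≡ 𝟙 b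
  𝟙-idem true = refl
  𝟙-idem false = refl
  𝟙-∧ : ∀ b c → 𝟙 (b ∧ c) ≡ 𝟙 b * 𝟙 c
  𝟙-∧ true true = refl
  𝟙-∧ true false = refl
  𝟙-∧ false c = refl
  square-+ : ∀ x y → (x + y) * ((x + y) * 1) ≡ x * x + y * (y * 1) + 2 * (x * y)
  square-+ = solve-∀
  regroup : ∀ x y z → x + (y + 2 * z) + 2 * (x * y) ≡ x + y + 2 * (x * y + z)
  regroup = solve-∀

-- Toggling coordinates

infixl 6 _⊕_
_⊕_ : ∀ {m} → Word m → Word m → Word m
_⊕_ = zipWith _xor_

toggle : ∀ {m} → Fin m → Word m → Word m
toggle i v = updateAt v i not

toggle-involutive : ∀ {m} (i : Fin m) v → toggle i (toggle i v) ≡ v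
toggle-involutive i v = trans (updateAt-updateAt-local i v (not-involutive (lookup v i))) (updateAt-id i v)

toggle-comm : ∀ {m} (i k : Fin m) v → toggle i (toggle k v) ≡ toggle k (toggle i v)
toggle-comm zero zero v = refl
toggle-comm zero (suc k) (_ ∷ _) = refl
toggle-comm (suc i) zero (_ ∷ _) = refl
toggle-comm (suc i) (suc k) (c ∷ v) = cong (c ∷_) (toggle-comm i k v)

toggle₂-involutive : ∀ {m} (i k : Fin m) v → toggle i (toggle k (toggle i (toggle k v))) ≡ v
toggle₂-involutive i k v =
  trans (cong (toggle i) (trans (toggle-comm k i (toggle k v)) (cong (toggle i) (toggle-involutive k v))))
        (toggle-involutive i v)

toggle-⊕ˡ : ∀ {m} (i : Fin m) x y → toggle i x ⊕ y ≡ toggle i (x ⊕ y)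
toggle-⊕ˡ zero (a ∷ x) (b ∷ y) = cong (_∷ _) (sym (not-distribˡ-xor a b))
toggle-⊕ˡ (suc i) (a ∷ x) (b ∷ y) = cong (_ ∷_) (toggle-⊕ˡ i x y)

toggle-⊕ʳ : ∀ {m} (i : Fin m) x y → x ⊕ toggle i y ≡ toggle i (x ⊕ y)
toggle-⊕ʳ zero (a ∷ x) (b ∷ y) = cong (_∷ _) (sym (not-distribʳ-xor a b))
toggle-⊕ʳ (suc i) (a ∷ x) (b ∷ y) = cong (_ ∷_) (toggle-⊕ʳ i x y)

parity-toggle : ∀ {m} (i : Fin m) v → parity (toggle i v) ≡ not (parity v)
parity-toggle zero (a ∷ v) = sym (not-distribˡ-xor a (parity v))
parity-toggle (suc i) (a ∷ v) = trans (cong (a xor_) (parity-toggle i v)) (sym (not-distribʳ-xor a (parity v)))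

parity-toggle₂ : ∀ {m} (i k : Fin m) v → parity (toggle i (toggle k v)) ≡ parity v
parity-toggle₂ i k v =
  trans (parity-toggle i (toggle k v)) (trans (cong not (parity-toggle k v)) (not-involutive (parity v)))

parity-++ : ∀ {m n} (x : Word m) (y : Word n) → parity (x ++ y) ≡ parity x xor parity y
parity-++ [] y = refl
parity-++ (a ∷ x) y = trans (cong (a xor_) (parity-++ x y)) (sym (xor-assoc a (parity x) (parity y)))

parity-⊕ : ∀ {m} (x y : Word m) → parity (x ⊕ y) ≡ parity x xor parity y
parity-⊕ [] [] = refl
parity-⊕ (a ∷ x) (b ∷ y) = begin
  (a xor b) xor parity (x ⊕ y)           ≡⟨ cong ((a xor b) xor_) (parity-⊕ x y) ⟩
  (a xor b) xor (parity x xor parity y)  ≡⟨ interchange a b (parity x) (parity y) ⟩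
  (a xor parity x) xor (b xor parity y)  ∎
  where open import Algebra.Properties.CommutativeSemigroup
          (CommutativeRing.+-commutativeSemigroup xor-∧-commutativeRing) using (interchange)

dot : ∀ {m} → Word m → Word m → Bool
dot μ y = parity (zipWith _∧_ μ y)

dot-toggle : ∀ {m} (μ : Word m) (i : Fin m) y → dot μ (toggle i y) ≡ dot μ y xor lookup μ i
dot-toggle (true ∷ μ) zero (c ∷ y) =
  sym (trans (xor-comm (c xor dot μ y) true) (not-distribˡ-xor c (dot μ y)))
dot-toggle (false ∷ μ) zero (c ∷ y) = sym (xor-identityʳ (dot μ y))
dot-toggle (b ∷ μ) (suc i) (c ∷ y) =
  trans (cong ((b ∧ c) xor_) (dot-toggle μ i y)) (sym (xor-assoc (b ∧ c) (dot μ y) (lookup μ i)))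

sign : ∀ {m} → Word m → Word m → Word m → Bool
sign μ x y = parity x xor dot μ y

sign-toggleˡ : ∀ {m} (μ : Word m) (i : Fin m) x y → sign μ (toggle i x) y ≡ not (sign μ x y)
sign-toggleˡ μ i x y =
  trans (cong (_xor dot μ y) (parity-toggle i x)) (sym (not-distribˡ-xor (parity x) (dot μ y)))

sign-toggleʳ : ∀ {m} (μ : Word m) (i : Fin m) x y → sign μ x (toggle i y) ≡ sign μ x y xor lookup μ i
sign-toggleʳ μ i x y =
  trans (cong (parity x xor_) (dot-toggle μ i y)) (sym (xor-assoc (parity x) (dot μ y) (lookup μ i)))

-- Counting neighbours in the halved cube

wordSum : ∀ m → (Word m → ℕ) → ℕ
wordSum zero f = f []
wordSum (suc m) f = wordSum m (λ u → f (false ∷ u)) + wordSum m (λ u → f (true ∷ u))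

wordSum-cong : ∀ {m} {f g : Word m → ℕ} → (∀ u → f u ≡ g u) → wordSum m f ≡ wordSum m g
wordSum-cong {zero} f≗g = f≗g []
wordSum-cong {suc m} f≗g = cong₂ _+_ (wordSum-cong (λ u → f≗g (false ∷ u))) (wordSum-cong (λ u → f≗g (true ∷ u)))

wordSum-zeros : ∀ m → wordSum m (λ _ → 0) ≡ 0
wordSum-zeros zero = refl
wordSum-zeros (suc m) = cong₂ _+_ (wordSum-zeros m) (wordSum-zeros m)

length-filter-map : ∀ {A B : Set} {p} {Q : B → Set p} (Q? : Decidable Q) (f : A → B) xs →
  length (filter Q? (map f xs)) ≡ length (filter (λ x → Q? (f x)) xs)
length-filter-map Q? f List.[] = refl
length-filter-map Q? f (x List.∷ xs) with does (Q? (f x))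
... | true = cong suc (length-filter-map Q? f xs)
... | false = length-filter-map Q? f xs

length-filter-allWords : ∀ {m p} {Q : Word m → Set p} (Q? : Decidable Q) →
  length (filter Q? (allWords m)) ≡ wordSum m (λ u → 𝟙 (does (Q? u)))
length-filter-allWords {zero} Q? with does (Q? [])
... | true = refl
... | false = refl
length-filter-allWords {suc m} Q? = begin
  length (filter Q? (map (false ∷_) (allWords m) Data.List.++ map (true ∷_) (allWords m)))
    ≡⟨ cong length (filter-++ Q? (map (false ∷_) (allWords m)) _) ⟩
  length (filter Q? (map (false ∷_) (allWords m)) Data.List.++ filter Q? (map (true ∷_) (allWords m)))
    ≡⟨ length-++ (filter Q? (map (false ∷_) (allWords m))) ⟩
  length (filter Q? (map (false ∷_) (allWords m))) + length (filter Q? (map (true ∷_) (allWords m)))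
    ≡⟨ cong₂ _+_ (trans (length-filter-map Q? _ (allWords m)) (length-filter-allWords (λ u → Q? (false ∷ u))))
                 (trans (length-filter-map Q? _ (allWords m)) (length-filter-allWords (λ u → Q? (true ∷ u)))) ⟩
  wordSum (suc m) (λ u → 𝟙 (does (Q? u))) ∎

wordSum-dist≡0 : ∀ {m} (v : Word m) (Q : Word m → ℕ) → wordSum m (λ u → 𝟙 (dist v u ≡ᵇ 0) * Q u) ≡ Q v
wordSum-dist≡0 [] Q = +-identityʳ (Q [])
wordSum-dist≡0 {suc m} (false ∷ v) Q =
  trans (cong₂ _+_ (wordSum-dist≡0 v (λ u → Q (false ∷ u))) (wordSum-zeros m)) (+-identityʳ _)
wordSum-dist≡0 {suc m} (true ∷ v) Q =
  cong₂ _+_ (wordSum-zeros m) (wordSum-dist≡0 v (λ u → Q (true ∷ u)))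

wordSum-dist≡1 : ∀ {m} (v : Word m) (Q : Word m → ℕ) →
  wordSum m (λ u → 𝟙 (dist v u ≡ᵇ 1) * Q u) ≡ ∑[ i < m ] Q (toggle i v)
wordSum-dist≡1 [] Q = refl
wordSum-dist≡1 (false ∷ v) Q =
  trans (cong₂ _+_ (wordSum-dist≡1 v (λ u → Q (false ∷ u))) (wordSum-dist≡0 v (λ u → Q (true ∷ u))))
        (+-comm (∑[ i < _ ] Q (false ∷ toggle i v)) (Q (true ∷ v)))
wordSum-dist≡1 (true ∷ v) Q =
  cong₂ _+_ (wordSum-dist≡0 v (λ u → Q (false ∷ u))) (wordSum-dist≡1 v (λ u → Q (true ∷ u)))

wordSum-dist≡2 : ∀ {m} (v : Word m) (Q : Word m → ℕ) →
  wordSum m (λ u → 𝟙 (dist v u ≡ᵇ 2) * Q u) ≡ ∑[ i < k < m ] Q (toggle i (toggle k v))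
wordSum-dist≡2 [] Q = refl
wordSum-dist≡2 (false ∷ v) Q =
  trans (cong₂ _+_ (wordSum-dist≡2 v (λ u → Q (false ∷ u))) (wordSum-dist≡1 v (λ u → Q (true ∷ u))))
        (+-comm (∑[ i < k < _ ] Q (false ∷ toggle i (toggle k v))) (∑[ k < _ ] Q (true ∷ toggle k v)))
wordSum-dist≡2 (true ∷ v) Q =
  cong₂ _+_ (wordSum-dist≡1 v (λ u → Q (false ∷ u))) (wordSum-dist≡2 v (λ u → Q (true ∷ u)))

𝟙-∧-∧ : ∀ a b c → 𝟙 (a ∧ (b ∧ c)) ≡ 𝟙 b * 𝟙 (a ∧ c)
𝟙-∧-∧ false true c = refl
𝟙-∧-∧ false false c = refl
𝟙-∧-∧ true false c = refl
𝟙-∧-∧ true true true = refl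
𝟙-∧-∧ true true false = refl

neighboursIn≡pairSum : ∀ {m k} (f : Word m → Fin k) v → Even v → ∀ j →
  neighboursIn f v j ≡ ∑[ i < l < m ] δ (f (toggle i (toggle l v))) j
neighboursIn≡pairSum {m} f v v-even j = begin
  neighboursIn f v j
    ≡⟨ length-filter-allWords (λ u → (parity u B.≟ false) ×-dec ((dist v u ℕ.≟ 2) ×-dec (f u ≟ j))) ⟩
  wordSum m (λ u → 𝟙 (does (parity u B.≟ false) ∧ ((dist v u ≡ᵇ 2) ∧ does (f u ≟ j))))
    ≡⟨ wordSum-cong (λ u → 𝟙-∧-∧ (does (parity u B.≟ false)) (dist v u ≡ᵇ 2) (does (f u ≟ j))) ⟩
  wordSum m (λ u → 𝟙 (dist v u ≡ᵇ 2) * 𝟙 (does (parity u B.≟ false) ∧ does (f u ≟ j)))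
    ≡⟨ wordSum-dist≡2 v (λ u → 𝟙 (does (parity u B.≟ false) ∧ does (f u ≟ j))) ⟩
  ∑[ i < l < m ] 𝟙 (does (parity (toggle i (toggle l v)) B.≟ false) ∧ does (f (toggle i (toggle l v)) ≟ j))
    ≡⟨ pairSum-cong (λ i l → cong (λ b → 𝟙 (does (b B.≟ false) ∧ does (f (toggle i (toggle l v)) ≟ j)))
                                  (trans (parity-toggle₂ i l v) v-even)) ⟩
  ∑[ i < l < m ] δ (f (toggle i (toggle l v))) j ∎

unitSum-++ : ∀ {n m} (x : Word n) (y : Word m) (g : Word (n + m) → ℕ) →
  ∑[ i < n + m ] g (toggle i (x ++ y)) ≡ ∑[ i < n ] g (toggle i x ++ y) + ∑[ k < m ] g (x ++ toggle k y)
unitSum-++ [] y g = refl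
unitSum-++ (c ∷ x) y g =
  trans (cong (g (not c ∷ (x ++ y)) +_) (unitSum-++ x y (λ w → g (c ∷ w))))
        (sym (+-assoc (g (not c ∷ (x ++ y))) _ _))

pairSum-++ : ∀ {n m} (x : Word n) (y : Word m) (g : Word (n + m) → ℕ) →
  ∑[ i < k < n + m ] g (toggle i (toggle k (x ++ y)))
    ≡ ∑[ i < k < n ] g (toggle i (toggle k x) ++ y)
      + ∑[ i < n ] ∑[ k < m ] g (toggle i x ++ toggle k y)
      + ∑[ i < k < m ] g (x ++ toggle i (toggle k y))
pairSum-++ [] y g = refl
pairSum-++ (c ∷ x) y g =
  trans (cong₂ _+_ (unitSum-++ x y (λ w → g (not c ∷ w))) (pairSum-++ x y (λ w → g (c ∷ w))))
        (regroup (∑[ i < _ ] g (not c ∷ (toggle i x ++ y))) (∑[ k < _ ] g (not c ∷ (x ++ toggle k y)))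
                 (∑[ i < k < _ ] g (c ∷ (toggle i (toggle k x) ++ y)))
                 (∑[ i < _ ] ∑[ k < _ ] g (c ∷ (toggle i x ++ toggle k y)))
                 (∑[ i < k < _ ] g (c ∷ (x ++ toggle i (toggle k y)))))
  where
  regroup : ∀ a₁ a₂ b₁ b₂ b₃ → (a₁ + a₂) + (b₁ + b₂ + b₃) ≡ (a₁ + b₁) + (a₂ + b₂) + b₃
  regroup = solve-∀

neighbourQuad : ∀ {n} → (Word (n + n) → ℕ) → Word n → Word n → Fin n → Fin n → ℕ
neighbourQuad g x y i k =
  (g (toggle i (toggle k x) ++ y) + g (x ++ toggle i (toggle k y)))
  + (g (toggle i x ++ toggle k y) + g (toggle k x ++ toggle i y))

pairSum-++-square : ∀ {n} (x y : Word n) (g : Word (n + n) → ℕ) →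
  ∑[ i < k < n + n ] g (toggle i (toggle k (x ++ y)))
    ≡ ∑[ i < k < n ] neighbourQuad g x y i k + ∑[ i < n ] g (toggle i x ++ toggle i y)
pairSum-++-square {n} x y g = begin
  ∑[ i < k < n + n ] g (toggle i (toggle k (x ++ y)))
    ≡⟨ pairSum-++ x y g ⟩
  T₁ + ∑[ i < n ] ∑[ k < n ] h i k + T₃
    ≡⟨ cong (λ t → T₁ + t + T₃) (∑∑-diagonal h) ⟩
  T₁ + (D + H) + T₃
    ≡⟨ regroup T₁ D H T₃ ⟩
  (T₁ + T₃) + H + D
    ≡⟨ cong (_+ D) (trans (pairSum-distrib-+ (λ i k → t₁ i k + t₃ i k) (λ i k → h i k + h k i))
                          (cong (_+ H) (pairSum-distrib-+ t₁ t₃))) ⟨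
  ∑[ i < k < n ] neighbourQuad g x y i k + D ∎
  where
  t₁ t₃ h : Fin n → Fin n → ℕ
  t₁ i k = g (toggle i (toggle k x) ++ y)
  t₃ i k = g (x ++ toggle i (toggle k y))
  h i k = g (toggle i x ++ toggle k y)
  T₁ = ∑[ i < k < n ] t₁ i k
  T₃ = ∑[ i < k < n ] t₃ i k
  D = ∑[ i < n ] h i i
  H = ∑[ i < k < n ] (h i k + h k i)
  regroup : ∀ a d b c → a + (d + b) + c ≡ (a + c) + b + d
  regroup = solve-∀

InFace-toggle : ∀ {n} (φ : Face n) (i : Fin n) v →
  lookup (freeMask φ) i ≡ true → InFace φ v → InFace φ (toggle i v)
InFace-toggle (nothing ∷ φ) zero (c ∷ v) _ v∈φ = v∈φ
InFace-toggle (nothing ∷ φ) (suc i) (c ∷ v) free v∈φ = InFace-toggle φ i v free v∈φ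
InFace-toggle (just b ∷ φ) (suc i) (c ∷ v) free (c≡b , v∈φ) = c≡b , InFace-toggle φ i v free v∈φ

numFree≡count : ∀ {n} (φ : Face n) → numFree φ ≡ ∑[ i < n ] 𝟙 (lookup (freeMask φ) i)
numFree≡count [] = refl
numFree≡count (nothing ∷ φ) = cong suc (numFree≡count φ)
numFree≡count (just b ∷ φ) = numFree≡count φ

bothFree : ∀ {n} → Face n → Fin n → Fin n → Bool
bothFree φ i k = lookup (freeMask φ) i ∧ lookup (freeMask φ) k

∧≡true : ∀ {p q} → p ∧ q ≡ true → p ≡ true × q ≡ true
∧≡true {true} {true} _ = refl , refl

-- The cells of C'

cell : Fin 2 → Bool → Fin 3
cell 0F σ = 0F
cell 1F σ = suc (if σ then 1F else 0F)

C'-cell : ∀ n (P : Word n → Fin 2) (F : Word n → Face n) w →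
  C' n P F w ≡ cell (P (take n w ⊕ drop n w)) (sign (freeMask (F (take n w ⊕ drop n w))) (take n w) (drop n w))
C'-cell n P F w with P (take n w ⊕ drop n w)
... | 0F = refl
... | 1F = if-suc (sign (freeMask (F (take n w ⊕ drop n w))) (take n w) (drop n w))
  where
  if-suc : ∀ σ → (if σ then 2F else 1F) ≡ suc (if σ then 1F else 0F)
  if-suc true = refl
  if-suc false = refl

C'-++ : ∀ {n} (P : Word n → Fin 2) (F : Word n → Face n) (x y : Word n) {z} → x ⊕ y ≡ z →
  C' n P F (x ++ y) ≡ cell (P z) (sign (freeMask (F z)) x y)
C'-++ {n} P F x y refl with ++-injective (take n (x ++ y)) x (take++drop≡id n (x ++ y))
... | take≡x , drop≡y =
  trans (C'-cell n P F (x ++ y))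
        (cong₂ (λ x′ y′ → cell (P (x′ ⊕ y′)) (sign (freeMask (F (x′ ⊕ y′))) x′ y′)) take≡x drop≡y)

-- How many of the four neighbours over z′ lie in cell j, given p = P z′, the sign t of (x, y)
-- with respect to the face of z′, and whether both toggled coordinates are free in that face.
fourCount : Fin 2 → Bool → Bool → Fin 3 → ℕ
fourCount 0F t both 0F = 4
fourCount 0F t both (suc j) = 0
fourCount 1F t both 0F = 0
fourCount 1F t true (suc j) = 4 * δ (cell 1F t) (suc j)
fourCount 1F t false (suc j) = 2

fourCells : ∀ p t α β j →
  (δ (cell p (not (not t))) j + δ (cell p ((t xor β) xor α)) j)
  + (δ (cell p (not (t xor β))) j + δ (cell p (not (t xor α))) j)
  ≡ fourCount p t (α ∧ β) j
fourCells 0F t α β 0F = refl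
fourCells 0F t α β (suc j) = refl
fourCells 1F t α β 0F = refl
fourCells 1F false false false 1F = refl
fourCells 1F false false false 2F = refl
fourCells 1F false false true 1F = refl
fourCells 1F false false true 2F = refl
fourCells 1F false true false 1F = refl
fourCells 1F false true false 2F = refl
fourCells 1F false true true 1F = refl
fourCells 1F false true true 2F = refl
fourCells 1F true false false 1F = refl
fourCells 1F true false false 2F = refl
fourCells 1F true false true 1F = refl
fourCells 1F true false true 2F = refl
fourCells 1F true true false 1F = refl
fourCells 1F true true false 2F = refl
fourCells 1F true true true 1F = refl
fourCells 1F true true true 2F = refl

fourCount-0 : ∀ p t both → fourCount p t both 0F ≡ 4 * δ p 0F
fourCount-0 0F t both = refl
fourCount-0 1F t both = refl

fourCount-sparse : ∀ p t both j → p ≡ 0F ⊎ both ≡ false → fourCount p t both (suc j) ≡ 2 * δ p 1F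
fourCount-sparse 0F t both j _ = refl
fourCount-sparse 1F t false j _ = refl
fourCount-sparse 1F t true j (inj₁ ())
fourCount-sparse 1F t true j (inj₂ ())

fourCount-own : ∀ t → fourCount 1F t true (cell 1F t) ≡ 4
fourCount-own false = refl
fourCount-own true = refl

fourCount-other : ∀ t → fourCount 1F t true (cell 1F (not t)) ≡ 0
fourCount-other false = refl
fourCount-other true = refl

diagonal-own : ∀ σ α → δ (cell 1F (not (σ xor α))) (cell 1F σ) ≡ 𝟙 α
diagonal-own false false = refl
diagonal-own false true = refl
diagonal-own true false = refl
diagonal-own true true = refl

diagonal-other : ∀ σ α → δ (cell 1F (not (σ xor α))) (cell 1F (not σ)) ≡ 𝟙 (not α)
diagonal-other false false = refl
diagonal-other false true = refl
diagonal-other true false = refl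
diagonal-other true true = refl

data ClassView (σ : Bool) : Fin 3 → Set where
  cell₀ : ClassView σ 0F
  own   : ClassView σ (cell 1F σ)
  other : ClassView σ (cell 1F (not σ))

classView : ∀ σ j → ClassView σ j
classView σ 0F = cell₀
classView false 1F = own
classView false 2F = other
classView true 1F = other
classView true 2F = own

module _ {a b c d n s : ℕ} where

  mat3-P₀ : ∀ j → mat3 a b c d n s 0F (suc j) ≡ 2 * b
  mat3-P₀ 0F = refl
  mat3-P₀ 1F = refl

  mat3-P₁-0 : ∀ σ → mat3 a b c d n s (cell 1F σ) 0F ≡ 4 * c
  mat3-P₁-0 false = refl
  mat3-P₁-0 true = refl

  mat3-own : ∀ σ → mat3 a b c d n s (cell 1F σ) (cell 1F σ) ≡ 2 * d + s ^ 2
  mat3-own false = refl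
  mat3-own true = refl

  mat3-other : ∀ σ → mat3 a b c d n s (cell 1F σ) (cell 1F (not σ)) ≡ (2 * d + n) ∸ s ^ 2
  mat3-other false = refl
  mat3-other true = refl

∸-cancel : ∀ t c u u′ → (t + 2 * c + (u + u′)) ∸ (u + 2 * c) ≡ t + u′
∸-cancel t c u u′ = trans (cong (_∸ (u + 2 * c)) (regroup t c u u′)) (m+n∸n≡m (t + u′) (u + 2 * c))
  where
  regroup : ∀ t c u u′ → t + 2 * c + (u + u′) ≡ t + u′ + (u + 2 * c)
  regroup = solve-∀

module Construction (n s a b c d : ℕ) (P : Word n → Fin 2) (F : Word n → Face n)
  (P-equitable : Equitable n 2 P (mat2 a b c d)) (F-partition : IsFacePartition n s P F) where

  same-face : ∀ v → Even v → P v ≡ 1F → ∀ i k → bothFree (F v) i k ≡ true →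
    P (toggle i (toggle k v)) ≡ 1F × F (toggle i (toggle k v)) ≡ F v
  same-face v v-even v∈P₁ i k both =
    let (_ , v∈Fv , Fv⊆P₁) = F-partition v v-even v∈P₁
        (free-i , free-k) = ∧≡true both
    in Fv⊆P₁ _ (trans (parity-toggle₂ i k v) v-even)
              (InFace-toggle (F v) i _ free-i (InFace-toggle (F v) k v free-k v∈Fv))

  same-face⁻¹ : ∀ v → Even v → ∀ i k →
    P (toggle i (toggle k v)) ≡ 1F → bothFree (F (toggle i (toggle k v))) i k ≡ true →
    P v ≡ 1F × F v ≡ F (toggle i (toggle k v))
  same-face⁻¹ v v-even i k v′∈P₁ both =
    subst (λ u → P u ≡ 1F × F u ≡ F (toggle i (toggle k v))) (toggle₂-involutive i k v)
          (same-face _ (trans (parity-toggle₂ i k v) v-even) v′∈P₁ i k both)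

  module AtVertex (x y : Word n) (xy-even : Even (x ++ y)) where

    z : Word n
    z = x ⊕ y

    z-even : Even z
    z-even = trans (parity-⊕ x y) (trans (sym (parity-++ x y)) xy-even)

    σ : Bool
    σ = sign (freeMask (F z)) x y

    four : Fin 3 → Fin n → Fin n → ℕ
    four j i k = fourCount (P (toggle i (toggle k z))) (sign (freeMask (F (toggle i (toggle k z)))) x y)
                           (bothFree (F (toggle i (toggle k z))) i k) j

    diagonal : Fin 2 → Fin 3 → Fin n → ℕ
    diagonal p j i = δ (cell p (not (σ xor lookup (freeMask (F z)) i))) j

    four-cells : ∀ j i k → neighbourQuad (λ w → δ (C' n P F w) j) x y i k ≡ four j i k
    four-cells j i k =
      trans (cong₂ _+_ (cong₂ _+_ (in-cell e₁ s₁) (in-cell e₂ s₂)) (cong₂ _+_ (in-cell e₃ s₃) (in-cell e₄ s₄)))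
            (fourCells (P z′) t α β j)
      where
      z′ = toggle i (toggle k z)
      μ = freeMask (F z′)
      t = sign μ x y
      α = lookup μ i
      β = lookup μ k
      in-cell : ∀ {x′ y′ σ′} → x′ ⊕ y′ ≡ z′ → sign μ x′ y′ ≡ σ′ → δ (C' n P F (x′ ++ y′)) j ≡ δ (cell (P z′) σ′) j
      in-cell e sgn = cong (λ c → δ c j) (trans (C'-++ P F _ _ e) (cong (cell (P z′)) sgn))
      e₁ : toggle i (toggle k x) ⊕ y ≡ z′
      e₁ = trans (toggle-⊕ˡ i (toggle k x) y) (cong (toggle i) (toggle-⊕ˡ k x y))
      e₂ : x ⊕ toggle i (toggle k y) ≡ z′
      e₂ = trans (toggle-⊕ʳ i x (toggle k y)) (cong (toggle i) (toggle-⊕ʳ k x y))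
      e₃ : toggle i x ⊕ toggle k y ≡ z′
      e₃ = trans (toggle-⊕ˡ i x (toggle k y)) (cong (toggle i) (toggle-⊕ʳ k x y))
      e₄ : toggle k x ⊕ toggle i y ≡ z′
      e₄ = trans (toggle-⊕ˡ k x (toggle i y)) (trans (cong (toggle k) (toggle-⊕ʳ i x y)) (toggle-comm k i z))
      s₁ : sign μ (toggle i (toggle k x)) y ≡ not (not t)
      s₁ = trans (sign-toggleˡ μ i (toggle k x) y) (cong not (sign-toggleˡ μ k x y))
      s₂ : sign μ x (toggle i (toggle k y)) ≡ (t xor β) xor α
      s₂ = trans (sign-toggleʳ μ i x (toggle k y)) (cong (_xor α) (sign-toggleʳ μ k x y))
      s₃ : sign μ (toggle i x) (toggle k y) ≡ not (t xor β)
      s₃ = trans (sign-toggleˡ μ i x (toggle k y)) (cong not (sign-toggleʳ μ k x y))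
      s₄ : sign μ (toggle k x) (toggle i y) ≡ not (t xor α)
      s₄ = trans (sign-toggleˡ μ k x (toggle i y)) (cong not (sign-toggleʳ μ i x y))

    diagonal-cell : ∀ j i → δ (C' n P F (toggle i x ++ toggle i y)) j ≡ diagonal (P z) j i
    diagonal-cell j i = cong (λ c → δ c j) (trans (C'-++ P F _ _ e) (cong (cell (P z)) sgn))
      where
      μ = freeMask (F z)
      e : toggle i x ⊕ toggle i y ≡ z
      e = trans (toggle-⊕ˡ i x (toggle i y)) (trans (cong (toggle i) (toggle-⊕ʳ i x y)) (toggle-involutive i z))
      sgn : sign μ (toggle i x) (toggle i y) ≡ not (σ xor lookup μ i)
      sgn = trans (sign-toggleˡ μ i x (toggle i y)) (cong not (sign-toggleʳ μ i x y))

    neighbours-C' : ∀ j →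
      neighboursIn (C' n P F) (x ++ y) j ≡ ∑[ i < k < n ] four j i k + ∑[ i < n ] diagonal (P z) j i
    neighbours-C' j = begin
      neighboursIn (C' n P F) (x ++ y) j
        ≡⟨ neighboursIn≡pairSum (C' n P F) (x ++ y) xy-even j ⟩
      ∑[ i < k < n + n ] g (toggle i (toggle k (x ++ y)))
        ≡⟨ pairSum-++-square x y g ⟩
      ∑[ i < k < n ] neighbourQuad g x y i k + ∑[ i < n ] g (toggle i x ++ toggle i y)
        ≡⟨ cong₂ _+_ (pairSum-cong (four-cells j)) (sum-cong-≗ (diagonal-cell j)) ⟩
      ∑[ i < k < n ] four j i k + ∑[ i < n ] diagonal (P z) j i ∎
      where
      g : Word (n + n) → ℕ
      g w = δ (C' n P F w) j

    inP : Fin 2 → Fin n → Fin n → ℕ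
    inP p i k = δ (P (toggle i (toggle k z))) p

    freePair : Fin n → Fin n → ℕ
    freePair i k = 𝟙 (bothFree (F z) i k)

    P-pairs : ∀ {p} → P z ≡ p → ∀ j → ∑[ i < k < n ] inP j i k ≡ mat2 a b c d p j
    P-pairs refl j = trans (sym (neighboursIn≡pairSum P z z-even j)) (P-equitable z z-even j)

    pairs-0 : ∀ {p} → P z ≡ p → ∑[ i < k < n ] four 0F i k ≡ 4 * mat2 a b c d p 0F
    pairs-0 pz =
      trans (pairSum-cong (λ i k → fourCount-0 (P (toggle i (toggle k z))) _ _))
            (trans (pairSum-*ˡ 4 (inP 0F)) (cong (4 *_) (P-pairs pz 0F)))

    sparse-pair : ∀ i k → (P z ≡ 1F → bothFree (F z) i k ≡ false) →
      P (toggle i (toggle k z)) ≡ 0F ⊎ bothFree (F (toggle i (toggle k z))) i k ≡ false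
    sparse-pair i k z-sparse
      with P (toggle i (toggle k z)) in z′∈P₁ | bothFree (F (toggle i (toggle k z))) i k in both′
    ... | 0F | _ = inj₁ refl
    ... | 1F | false = inj₂ refl
    ... | 1F | true with same-face⁻¹ z z-even i k z′∈P₁ both′
    ...   | z∈P₁ , Fz≡Fz′ =
      contradiction (trans (sym (z-sparse z∈P₁)) (trans (cong (λ φ → bothFree φ i k) Fz≡Fz′) both′)) λ ()

    count-P₀ : P z ≡ 0F → ∀ j → ∑[ i < k < n ] four j i k + ∑[ i < n ] diagonal 0F j i ≡ mat3 a b c d n s 0F j
    count-P₀ pz 0F = cong₂ _+_ (pairs-0 pz) (∑-ones n)
    count-P₀ pz (suc j) = begin
      ∑[ i < k < n ] four (suc j) i k + ∑[ i < n ] diagonal 0F (suc j) i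
        ≡⟨ cong₂ _+_ (pairSum-cong sparse) (sum-replicate-zero n) ⟩
      ∑[ i < k < n ] (2 * inP 1F i k) + 0
        ≡⟨ +-identityʳ _ ⟩
      ∑[ i < k < n ] (2 * inP 1F i k)
        ≡⟨ pairSum-*ˡ 2 (inP 1F) ⟩
      2 * ∑[ i < k < n ] inP 1F i k
        ≡⟨ cong (2 *_) (P-pairs pz 1F) ⟩
      2 * b
        ≡⟨ mat3-P₀ j ⟨
      mat3 a b c d n s 0F (suc j) ∎
      where
      sparse : ∀ i k → four (suc j) i k ≡ 2 * inP 1F i k
      sparse i k = fourCount-sparse _ _ _ j (sparse-pair i k (λ z∈P₁ → contradiction (trans (sym pz) z∈P₁) λ ()))

    S S′ C : ℕ
    S = ∑[ i < n ] 𝟙 (lookup (freeMask (F z)) i)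
    S′ = ∑[ i < n ] 𝟙 (not (lookup (freeMask (F z)) i))
    C = ∑[ i < k < n ] freePair i k

    S≡s : P z ≡ 1F → S ≡ s
    S≡s pz = trans (sym (numFree≡count (F z))) (proj₁ (F-partition z z-even pz))

    S² : S ^ 2 ≡ S + 2 * C
    S² = count-square (lookup (freeMask (F z)))

    pair-own : P z ≡ 1F → ∀ i k →
      four (cell 1F σ) i k ≡ 2 * inP 1F i k + 2 * freePair i k
    pair-own pz i k with bothFree (F z) i k in both
    ... | false = trans (fourCount-sparse _ _ _ _ (sparse-pair i k (λ _ → both))) (sym (+-identityʳ _))
    ... | true with same-face z z-even pz i k both
    ...   | Pz′≡1F , Fz′≡Fz rewrite Pz′≡1F | Fz′≡Fz | both = fourCount-own σ

    pair-other : P z ≡ 1F → ∀ i k →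
      four (cell 1F (not σ)) i k + 2 * freePair i k ≡ 2 * inP 1F i k
    pair-other pz i k with bothFree (F z) i k in both
    ... | false = trans (+-identityʳ _) (fourCount-sparse _ _ _ _ (sparse-pair i k (λ _ → both)))
    ... | true with same-face z z-even pz i k both
    ...   | Pz′≡1F , Fz′≡Fz rewrite Pz′≡1F | Fz′≡Fz | both = cong (_+ 2) (fourCount-other σ)

    count-P₁ : P z ≡ 1F → ∀ j →
      ∑[ i < k < n ] four j i k + ∑[ i < n ] diagonal 1F j i ≡ mat3 a b c d n s (cell 1F σ) j
    count-P₁ pz j with classView σ j
    ... | cell₀ =
      trans (cong₂ _+_ (pairs-0 pz) (sum-replicate-zero n)) (trans (+-identityʳ (4 * c)) (sym (mat3-P₁-0 σ)))
    ... | own = begin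
      ∑[ i < k < n ] four (cell 1F σ) i k + ∑[ i < n ] diagonal 1F (cell 1F σ) i
        ≡⟨ cong₂ _+_ (pairSum-cong (pair-own pz)) (sum-cong-≗ (λ i → diagonal-own σ (lookup (freeMask (F z)) i))) ⟩
      ∑[ i < k < n ] (2 * inP 1F i k + 2 * freePair i k) + S
        ≡⟨ cong (_+ S) (trans (pairSum-distrib-+ (λ i k → 2 * inP 1F i k) (λ i k → 2 * freePair i k))
                              (cong₂ _+_ (trans (pairSum-*ˡ 2 (inP 1F)) (cong (2 *_) (P-pairs pz 1F)))
                                         (pairSum-*ˡ 2 freePair))) ⟩
      2 * d + 2 * C + S
        ≡⟨ trans (+-assoc (2 * d) (2 * C) S) (cong (2 * d +_) (+-comm (2 * C) S)) ⟩
      2 * d + (S + 2 * C)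
        ≡⟨ cong (λ t → 2 * d + t) (trans (sym S²) (cong (_^ 2) (S≡s pz))) ⟩
      2 * d + s ^ 2
        ≡⟨ mat3-own σ ⟨
      mat3 a b c d n s (cell 1F σ) (cell 1F σ) ∎
    ... | other = begin
      ∑[ i < k < n ] four (cell 1F (not σ)) i k + ∑[ i < n ] diagonal 1F (cell 1F (not σ)) i
        ≡⟨ cong (pairs +_) (sum-cong-≗ (λ i → diagonal-other σ (lookup (freeMask (F z)) i))) ⟩
      pairs + S′
        ≡⟨ ∸-cancel pairs C S S′ ⟨
      (pairs + 2 * C + (S + S′)) ∸ (S + 2 * C)
        ≡⟨ cong₂ _∸_ (cong₂ _+_ pairs+2C (count-complement (lookup (freeMask (F z)))))
                     (trans (sym S²) (cong (_^ 2) (S≡s pz))) ⟩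
      (2 * d + n) ∸ s ^ 2
        ≡⟨ mat3-other σ ⟨
      mat3 a b c d n s (cell 1F σ) (cell 1F (not σ)) ∎
      where
      pairs = ∑[ i < k < n ] four (cell 1F (not σ)) i k
      pairs+2C : pairs + 2 * C ≡ 2 * d
      pairs+2C = begin
        pairs + 2 * C
          ≡⟨ cong (pairs +_) (pairSum-*ˡ 2 freePair) ⟨
        pairs + ∑[ i < k < n ] (2 * freePair i k)
          ≡⟨ pairSum-distrib-+ (four (cell 1F (not σ))) (λ i k → 2 * freePair i k) ⟨
        ∑[ i < k < n ] (four (cell 1F (not σ)) i k + 2 * freePair i k)
          ≡⟨ pairSum-cong (pair-other pz) ⟩
        ∑[ i < k < n ] (2 * inP 1F i k)
          ≡⟨ trans (pairSum-*ˡ 2 (inP 1F)) (cong (2 *_) (P-pairs pz 1F)) ⟩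
        2 * d ∎

    count : ∀ j → ∑[ i < k < n ] four j i k + ∑[ i < n ] diagonal (P z) j i ≡ mat3 a b c d n s (cell (P z) σ) j
    count j with P z in pz
    ... | 0F = count-P₀ pz j
    ... | 1F = count-P₁ pz j

    C'-neighbours : ∀ j → neighboursIn (C' n P F) (x ++ y) j ≡ mat3 a b c d n s (C' n P F (x ++ y)) j
    C'-neighbours j =
      trans (neighbours-C' j) (trans (count j) (cong (λ cl → mat3 a b c d n s cl j) (sym (C'-++ P F x y refl))))

  C'-equitable : Equitable (n + n) 3 (C' n P F) (mat3 a b c d n s)
  C'-equitable w w-even j =
    subst (λ u → Even u → neighboursIn (C' n P F) u j ≡ mat3 a b c d n s (C' n P F u) j)
          (take++drop≡id n w) (λ ev → AtVertex.C'-neighbours (take n w) (drop n w) ev j) w-even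

lemma5 : ∀ (n s a b c d : ℕ) (P : Word n → Fin 2) (F : Word n → Face n) →
  Equitable n 2 P (mat2 a b c d) → IsFacePartition n s P F →
  Equitable (n + n) 3 (C' n P F) (mat3 a b c d n s)
lemma5 = Construction.C'-equitable
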